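{- Define a map $\psi$ from open Deutsch paths to Motzkin paths recursively: $\psi$ maps the empty path to the empty path; if a nonempty open Deutsch path $w$ never returns to the $x$-axis after its start, write $w=U\widetilde w$ where $U$ is the initial up-step and $\widetilde w$ (shifted down by one unit) is an open Deutsch path, and set $\psi(w)=F\,\psi(\widetilde w)$ with $F$ a flat step $(1,0)$; otherwise write $w=U\widetilde w\,D\,x$, where $D$ is the down-step (of some size) by which $w$ first returns to the $x$-axis, $\widetilde w$ (shifted down by one unit) is an open Deutsch path, and $x$ is an open Deutsch path, and set $\psi(w)=U\,\psi(\widetilde w)\,D'\,\psi(x)$ where $U$ is the step $(1,1)$ and $D'$ is the step $(1,-1)$. Then $\psi$ is a bijection from the set of open Deutsch paths of length $n$ onto the set of Motzkin paths of length $n$, for every $n\ge0$.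
   Context: A Deutsch path of length $n$ is a lattice path starting at $(0,0)$ consisting of $n$ steps, each either an up-step $(1,1)$ or a down-step $(1,-k)$ for some integer $k\ge1$, which never goes below the $x$-axis; it is open if its ending level is arbitrary. A Motzkin path of length $n$ is a lattice path from $(0,0)$ to $(n,0)$ with steps $(1,1)$, $(1,0)$, $(1,-1)$ never going below the $x$-axis. -}

module Defs where

open import Data.Nat using (ℕ; zero; suc; _∸_; _≤_; _≤?_)
open import Data.List using (List; []; _∷_; length)
open import Data.Maybe using (Maybe; just; nothing)
open import Data.Product using (_×_; _,_; Σ; ∃)
open import Data.Unit using (⊤)
open import Data.Empty using (⊥)
open import Relation.Nullary using (yes; no)
open import Relation.Binary.PropositionalEquality using (_≡_)

-- Deutsch steps: up = (1,1); down k = (1, -(k+1)), i.e. a down-step of size k+1 ≥ 1.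
data DStep : Set where
  up   : DStep
  down : ℕ → DStep

DValid : ℕ → List DStep → Set
DValid h []           = ⊤
DValid h (up ∷ s)     = DValid (suc h) s
DValid h (down k ∷ s) = (suc k ≤ h) × DValid (h ∸ suc k) s

OpenDeutsch : ℕ → List DStep → Set
OpenDeutsch n w = (length w ≡ n) × DValid 0 w

data MStep : Set where
  U F D : MStep

MValid : ℕ → List MStep → Set
MValid h []            = h ≡ 0
MValid h (U ∷ s)       = MValid (suc h) s
MValid h (F ∷ s)       = MValid h s
MValid zero (D ∷ s)    = ⊥
MValid (suc h) (D ∷ s) = MValid h s

Motzkin : ℕ → List MStep → Set
Motzkin n m = (length m ≡ n) × MValid 0 m

private
  prepend : DStep → Maybe (List DStep × List DStep) → Maybe (List DStep × List DStep)
  prepend s nothing        = nothing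
  prepend s (just (a , b)) = just (s ∷ a , b)

firstReturn : ℕ → List DStep → Maybe (List DStep × List DStep)
firstReturn h []           = nothing
firstReturn h (up ∷ s)     = prepend up (firstReturn (suc h) s)
firstReturn h (down k ∷ s) with h ≤? suc k
... | yes _ = just ([] , s)
... | no  _ = prepend (down k) (firstReturn (h ∸ suc k) s)

-- ψ with a fuel argument (fuel = length suffices since recursive calls are on
-- strictly shorter paths). Shifting a path down is invisible on step lists.
ψ′ : ℕ → List DStep → List MStep
ψ′ zero       _            = []
ψ′ (suc f)    []           = []
ψ′ (suc f)    (down k ∷ s) = []   -- not a Deutsch path; irrelevant
ψ′ (suc f)    (up ∷ s) with firstReturn 1 s
... | nothing       = F ∷ ψ′ f s
... | just (w̃ , x) = U ∷ (ψ′ f w̃ Data.List.++ (D ∷ ψ′ f x))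

ψ : List DStep → List MStep
ψ w = ψ′ (length w) w

module Submission where

-- Every open Deutsch path w has a *first-return decomposition*: it is
-- empty, or  up ∷ s  with s an open Deutsch path that never returns to the axis
-- (a "lifted" path), or  up ∷ a ++ down k ∷ b  where the down-step first reaches
-- the axis, so that a and b are again open Deutsch paths.
-- Soundness (ψ w is a Motzkin path of the same length) and injectivity then
-- follow by structural recursion on trees; injectivity uses that a Motzkin path
-- determines its decomposition  a ++ D ∷ b  with a balanced.  Surjectivity
-- decomposes a Motzkin path at its first return from level 1 and rebuilds a tree.

open import Defs
open import Data.Nat using (ℕ; zero; suc; _+_; _∸_; _≤_; _≤?_; s≤s)
open import Data.Nat.Properties
  using (≤-refl; ≤-trans; <-irrefl; <⇒≤; m≤n⇒m≤1+n; m≤n⇒m<n∨m≡n; n∸n≡0; +-∸-assoc; m+n≤o⇒m≤o; m+n≤o⇒n≤o)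
open import Data.List using (List; []; _∷_; length; _++_)
open import Data.List.Properties using (length-++; ∷-injective; ∷-injectiveˡ; ∷-injectiveʳ)
open import Data.Maybe using (just; nothing)
open import Data.Product using (_×_; Σ; _,_; proj₁; proj₂)
open import Data.Sum using (inj₁; inj₂)
open import Data.Unit using (tt)
open import Data.Empty using (⊥-elim)
open import Relation.Nullary using (yes; no)
open import Relation.Binary.PropositionalEquality
  using (_≡_; refl; sym; trans; cong; cong₂; subst; module ≡-Reasoning)

endLevel : ℕ → List DStep → ℕ
endLevel h []           = h
endLevel h (up ∷ s)     = endLevel (suc h) s
endLevel h (down k ∷ s) = endLevel (h ∸ suc k) s

∸-shift : ∀ {h k} → suc k ≤ h → h ∸ k ≡ suc (h ∸ suc k)
∸-shift p = +-∸-assoc 1 p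

DValid-raise : ∀ h s → DValid h s → DValid (suc h) s
DValid-raise h []           v       = tt
DValid-raise h (up ∷ s)     v       = DValid-raise (suc h) s v
DValid-raise h (down k ∷ s) (p , v) =
  m≤n⇒m≤1+n p , subst (λ l → DValid l s) (sym (∸-shift p)) (DValid-raise (h ∸ suc k) s v)

DValid-return : ∀ h a b → DValid h a → DValid 0 b → DValid (suc h) (a ++ down (endLevel h a) ∷ b)
DValid-return h []           b va       vb rewrite n∸n≡0 h = ≤-refl , vb
DValid-return h (up ∷ s)     b va       vb = DValid-return (suc h) s b va vb
DValid-return h (down k ∷ s) b (p , va) vb =
  m≤n⇒m≤1+n p ,
  subst (λ l → DValid l (s ++ down (endLevel (h ∸ suc k) s) ∷ b)) (sym (∸-shift p))
        (DValid-return (h ∸ suc k) s b va vb)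

data Return (h : ℕ) : List DStep → Set where
  stays   : ∀ {s} → DValid h s → Return h s
  returns : ∀ {a b} → DValid h a → DValid 0 b → Return h (a ++ down (endLevel h a) ∷ b)

classify : ∀ h s → DValid (suc h) s → Return h s
classify h []           v = stays tt
classify h (up ∷ s)     v with classify (suc h) s v
... | stays v'              = stays v'
... | returns {a} {b} va vb = returns {a = up ∷ a} {b} va vb
classify h (down k ∷ s) (s≤s k≤h , v) with m≤n⇒m<n∨m≡n k≤h
... | inj₂ refl rewrite n∸n≡0 k = returns {a = []} tt v
... | inj₁ k<h with classify (h ∸ suc k) s (subst (λ l → DValid l s) (∸-shift k<h) v)
...   | stays v'              = stays (k<h , v')
...   | returns {a} {b} va vb = returns {a = down k ∷ a} {b} (k<h , va) vb

firstReturn-none : ∀ h s → DValid h s → firstReturn (suc h) s ≡ nothing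
firstReturn-none h []           v = refl
firstReturn-none h (up ∷ s)     v rewrite firstReturn-none (suc h) s v = refl
firstReturn-none h (down k ∷ s) (p , v) with suc h ≤? suc k
... | yes (s≤s h≤k) = ⊥-elim (<-irrefl refl (≤-trans p h≤k))
... | no _ rewrite ∸-shift p | firstReturn-none (h ∸ suc k) s v = refl

firstReturn-found : ∀ h a b → DValid h a →
  firstReturn (suc h) (a ++ down (endLevel h a) ∷ b) ≡ just (a , b)
firstReturn-found h []           b v with suc h ≤? suc h
... | yes _   = refl
... | no h≰h  = ⊥-elim (h≰h ≤-refl)
firstReturn-found h (up ∷ s)     b v rewrite firstReturn-found (suc h) s b v = refl
firstReturn-found h (down k ∷ s) b (p , v) with suc h ≤? suc k
... | yes (s≤s h≤k) = ⊥-elim (<-irrefl refl (≤-trans p h≤k))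
... | no _ rewrite ∸-shift p | firstReturn-found (h ∸ suc k) s b v = refl

data Tree : List DStep → Set where
  empty     : Tree []
  lifted    : ∀ {s} → Tree s → Tree (up ∷ s)
  returning : ∀ {a b} → Tree a → Tree b → Tree (up ∷ (a ++ down (endLevel 0 a) ∷ b))

length-pieces : ∀ {A : Set} (a : List A) x b {n} → length (a ++ x ∷ b) ≤ n →
  length a ≤ n × length b ≤ n
length-pieces a x b p rewrite length-++ a {x ∷ b} =
  m+n≤o⇒m≤o (length a) p , <⇒≤ (m+n≤o⇒n≤o (length a) p)

-- Every path with a tree is an open Deutsch path ...
valid : ∀ {w} → Tree w → DValid 0 w
valid empty                     = tt
valid (lifted {s} t)            = DValid-raise 0 s (valid t)
valid (returning {a} {b} ta tb) = DValid-return 0 a b (valid ta) (valid tb)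

-- ... and conversely (recursion on a length bound n, since the pieces a and b
-- are not structural subterms of w).
treeWithin : ∀ n w → length w ≤ n → DValid 0 w → Tree w
treeWithin n       []           _       _ = empty
treeWithin (suc n) (up ∷ s)     (s≤s p) v with classify 0 s v
... | stays v'                = lifted (treeWithin n s p v')
... | returns {a} {b} va vb =
  returning (treeWithin n a (proj₁ bounds) va) (treeWithin n b (proj₂ bounds) vb)
  where bounds = length-pieces a _ b p

tree : ∀ w → DValid 0 w → Tree w
tree w = treeWithin (length w) w ≤-refl

ψ′-lifted : ∀ f s → DValid 0 s → ψ′ (suc f) (up ∷ s) ≡ F ∷ ψ′ f s
ψ′-lifted f s v rewrite firstReturn-none 0 s v = refl

ψ′-returning : ∀ f a b → DValid 0 a →
  ψ′ (suc f) (up ∷ (a ++ down (endLevel 0 a) ∷ b)) ≡ U ∷ (ψ′ f a ++ D ∷ ψ′ f b)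
ψ′-returning f a b va rewrite firstReturn-found 0 a b va = refl

ψ-lifted : ∀ {s} → Tree s → ψ (up ∷ s) ≡ F ∷ ψ s
ψ-lifted {s} t = ψ′-lifted (length s) s (valid t)

mutual
  ψ′-saturated : ∀ {w} f → Tree w → length w ≤ f → ψ′ f w ≡ ψ w
  ψ′-saturated zero    empty _ = refl
  ψ′-saturated (suc f) empty _ = refl
  ψ′-saturated (suc f) (lifted {s} t) (s≤s p) = begin
    ψ′ (suc f) (up ∷ s)  ≡⟨ ψ′-lifted f s (valid t) ⟩
    F ∷ ψ′ f s           ≡⟨ cong (F ∷_) (ψ′-saturated f t p) ⟩
    F ∷ ψ s              ≡⟨ sym (ψ-lifted t) ⟩
    ψ (up ∷ s)           ∎
    where open ≡-Reasoning
  ψ′-saturated (suc f) (returning {a} {b} ta tb) (s≤s p) = begin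
    ψ′ (suc f) (up ∷ (a ++ down (endLevel 0 a) ∷ b))  ≡⟨ ψ′-returning f a b (valid ta) ⟩
    U ∷ (ψ′ f a ++ D ∷ ψ′ f b)  ≡⟨ cong₂ (λ x y → U ∷ (x ++ D ∷ y))
                                     (ψ′-saturated f ta (proj₁ bounds))
                                     (ψ′-saturated f tb (proj₂ bounds)) ⟩
    U ∷ (ψ a ++ D ∷ ψ b)        ≡⟨ sym (ψ-returning ta tb) ⟩
    ψ (up ∷ (a ++ down (endLevel 0 a) ∷ b))  ∎
    where open ≡-Reasoning
          bounds = length-pieces a _ b p

  ψ-returning : ∀ {a b} → Tree a → Tree b →
    ψ (up ∷ (a ++ down (endLevel 0 a) ∷ b)) ≡ U ∷ (ψ a ++ D ∷ ψ b)
  ψ-returning {a} {b} ta tb =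
    trans (ψ′-returning L a b (valid ta))
          (cong₂ (λ x y → U ∷ (x ++ D ∷ y))
                 (ψ′-saturated L ta (proj₁ bounds)) (ψ′-saturated L tb (proj₂ bounds)))
    where L = length (a ++ down (endLevel 0 a) ∷ b)
          bounds = length-pieces a _ b {L} ≤-refl

MValid-++ : ∀ {h h'} s {t} → MValid h s → MValid h' t → MValid (h + h') (s ++ t)
MValid-++ {h = zero}  []      refl vt = vt
MValid-++             (U ∷ s) vs   vt = MValid-++ s vs vt
MValid-++             (F ∷ s) vs   vt = MValid-++ s vs vt
MValid-++ {h = suc h} (D ∷ s) vs   vt = MValid-++ s vs vt

first-descent : ∀ j h s → MValid (suc (j + h)) s →
  Σ (List MStep) λ a → Σ (List MStep) λ b → (s ≡ a ++ D ∷ b) × MValid j a × MValid h b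
first-descent j h [] ()
first-descent j h (U ∷ s) v with first-descent (suc j) h s v
... | a , b , refl , va , vb = U ∷ a , b , refl , va , vb
first-descent j h (F ∷ s) v with first-descent j h s v
... | a , b , refl , va , vb = F ∷ a , b , refl , va , vb
first-descent zero    h (D ∷ s) v = [] , s , refl , refl , v
first-descent (suc j) h (D ∷ s) v with first-descent j h s v
... | a , b , refl , va , vb = D ∷ a , b , refl , va , vb

descent-unique : ∀ j x x' {y y'} → MValid j x → MValid j x' →
  x ++ D ∷ y ≡ x' ++ D ∷ y' → x ≡ x' × y ≡ y'
descent-unique j []      []       v    v'   e = refl , ∷-injectiveʳ e
descent-unique j []      (c ∷ x') refl v'   e with ∷-injectiveˡ e
... | refl = ⊥-elim v'
descent-unique j (c ∷ x) []       v    refl e with ∷-injectiveˡ e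
... | refl = ⊥-elim v
descent-unique j (c ∷ x) (c' ∷ x') v   v'   e with ∷-injective e
descent-unique j       (U ∷ x) (U ∷ x') v v' e | refl , e' with descent-unique (suc j) x x' v v' e'
... | refl , y≡y' = refl , y≡y'
descent-unique j       (F ∷ x) (F ∷ x') v v' e | refl , e' with descent-unique j x x' v v' e'
... | refl , y≡y' = refl , y≡y'
descent-unique (suc j) (D ∷ x) (D ∷ x') v v' e | refl , e' with descent-unique j x x' v v' e'
... | refl , y≡y' = refl , y≡y'

ψ-motzkin : ∀ {w} → Tree w → MValid 0 (ψ w)
ψ-motzkin empty                 = refl
ψ-motzkin (lifted t)            = subst (MValid 0) (sym (ψ-lifted t)) (ψ-motzkin t)
ψ-motzkin (returning {a} ta tb) =
  subst (MValid 0) (sym (ψ-returning ta tb)) (MValid-++ {0} {1} (ψ a) (ψ-motzkin ta) (ψ-motzkin tb))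

ψ-length : ∀ {w} → Tree w → length (ψ w) ≡ length w
ψ-length empty          = refl
ψ-length (lifted {s} t) = begin
  length (ψ (up ∷ s))  ≡⟨ cong length (ψ-lifted t) ⟩
  suc (length (ψ s))   ≡⟨ cong suc (ψ-length t) ⟩
  suc (length s)       ∎
  where open ≡-Reasoning
ψ-length (returning {a} {b} ta tb) = begin
  length (ψ (up ∷ (a ++ down (endLevel 0 a) ∷ b)))  ≡⟨ cong length (ψ-returning ta tb) ⟩
  suc (length (ψ a ++ D ∷ ψ b))                    ≡⟨ cong suc (length-++ (ψ a)) ⟩
  suc (length (ψ a) + suc (length (ψ b)))          ≡⟨ cong₂ (λ x y → suc (x + suc y)) (ψ-length ta) (ψ-length tb) ⟩
  suc (length a + suc (length b))                  ≡⟨ cong suc (sym (length-++ a)) ⟩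
  suc (length (a ++ down (endLevel 0 a) ∷ b))      ∎
  where open ≡-Reasoning

same-length : ∀ {w v} → Tree w → Tree v → ψ w ≡ ψ v → length w ≡ length v
same-length tw tv e = trans (sym (ψ-length tw)) (trans (cong length e) (ψ-length tv))

ψ-injective : ∀ {w v} → Tree w → Tree v → ψ w ≡ ψ v → w ≡ v
ψ-injective empty empty _ = refl
ψ-injective empty (lifted t)        e with same-length empty (lifted t) e
... | ()
ψ-injective empty (returning ta tb) e with same-length empty (returning ta tb) e
... | ()
ψ-injective (lifted t)        empty e with same-length (lifted t) empty e
... | ()
ψ-injective (returning ta tb) empty e with same-length (returning ta tb) empty e
... | ()
ψ-injective (lifted t) (lifted t') e =
  cong (up ∷_) (ψ-injective t t' (∷-injectiveʳ (trans (sym (ψ-lifted t)) (trans e (ψ-lifted t')))))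
ψ-injective (lifted t) (returning ta tb) e
  with ∷-injectiveˡ (trans (sym (ψ-lifted t)) (trans e (ψ-returning ta tb)))
... | ()
ψ-injective (returning ta tb) (lifted t) e
  with ∷-injectiveˡ (trans (sym (ψ-returning ta tb)) (trans e (ψ-lifted t)))
... | ()
ψ-injective (returning {a} ta tb) (returning {a'} ta' tb') e
  with descent-unique 0 (ψ a) (ψ a') (ψ-motzkin ta) (ψ-motzkin ta')
         (∷-injectiveʳ (trans (sym (ψ-returning ta tb)) (trans e (ψ-returning ta' tb'))))
... | ψa≡ψa' , ψb≡ψb' =
  cong₂ (λ x y → up ∷ (x ++ down (endLevel 0 x) ∷ y))
        (ψ-injective ta ta' ψa≡ψa') (ψ-injective tb tb' ψb≡ψb')

ψ-surjective : ∀ n m → length m ≤ n → MValid 0 m → Σ (List DStep) λ w → Tree w × ψ w ≡ m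
ψ-surjective n       []      _       _ = [] , empty , refl
ψ-surjective (suc n) (F ∷ m) (s≤s p) v with ψ-surjective n m p v
... | w , t , ψw≡m = up ∷ w , lifted t , trans (ψ-lifted t) (cong (F ∷_) ψw≡m)
ψ-surjective (suc n) (U ∷ m) (s≤s p) v with first-descent 0 0 m v
... | a , b , refl , va , vb
  with ψ-surjective n a (proj₁ (length-pieces a D b p)) va
     | ψ-surjective n b (proj₂ (length-pieces a D b p)) vb
... | wa , ta , ψwa≡a | wb , tb , ψwb≡b =
  up ∷ (wa ++ down (endLevel 0 wa) ∷ wb) , returning ta tb ,
  trans (ψ-returning ta tb) (cong₂ (λ x y → U ∷ (x ++ D ∷ y)) ψwa≡a ψwb≡b)

mainTheorem4 : (n : ℕ) →
    ((w : List DStep) → OpenDeutsch n w → Motzkin n (ψ w))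
    × ((w v : List DStep) → OpenDeutsch n w → OpenDeutsch n v → ψ w ≡ ψ v → w ≡ v)
    × ((m : List MStep) → Motzkin n m → Σ (List DStep) (λ w → OpenDeutsch n w × ψ w ≡ m))
mainTheorem4 n = sound , injective , surjective
  where
  sound : (w : List DStep) → OpenDeutsch n w → Motzkin n (ψ w)
  sound w (len , v) = trans (ψ-length (tree w v)) len , ψ-motzkin (tree w v)

  injective : (w v : List DStep) → OpenDeutsch n w → OpenDeutsch n v → ψ w ≡ ψ v → w ≡ v
  injective w v (_ , vw) (_ , vv) = ψ-injective (tree w vw) (tree v vv)

  surjective : (m : List MStep) → Motzkin n m → Σ (List DStep) (λ w → OpenDeutsch n w × ψ w ≡ m)
  surjective m (len , v) with ψ-surjective (length m) m ≤-refl v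
  ... | w , t , ψw≡m = w , (trans (sym (ψ-length t)) (trans (cong length ψw≡m) len) , valid t) , ψw≡m
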